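{- Let $k\ge2$ be an integer, $H$ a positive integer, and $M,M'$ real numbers with $1\le M<M'\le 2M$ and $M^{1-1/k}\le H$. Then $\Phi(0)\ll HM^{2/k-1}$, with implicit constant depending only on $k$.
   Context: Let $e(\alpha)=e^{2\pi i\alpha}$ and $w(h)=\max\bigl(1-\frac{|h|}{2H},0\bigr)$ for integers $h$. Define \[\Phi(\alpha)=\sum_{M<m_1^k\le M'}\ \sum_{M<m_2^k\le M'}w(m_1^k-m_2^k)\,e\bigl((m_1^k-m_2^k)\alpha\bigr),\] where $m_1,m_2$ run over positive integers.
   Formalization: The parameters $M,M'$ are rational rather than real numbers. -}

module Defs where

open import Data.Bool using (Bool; _∧_; not)
open import Data.Nat as ℕ using (ℕ; zero; suc; NonZero)
open import Data.Integer as ℤ using (ℤ; +_)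
open import Data.Rational using (ℚ; _/_; _+_; _-_; _*_; ∣_∣; _⊔_; _≤ᵇ_; 0ℚ; 1ℚ; ½; floor)
open import Data.List using (List; map; upTo; filterᵇ; foldr)

ι : ℕ → ℚ
ι n = + n / 1

ιℤ : ℤ → ℚ
ιℤ z = z / 1

powℚ : ℚ → ℕ → ℚ
powℚ q zero    = 1ℚ
powℚ q (suc n) = q * powℚ q n

sumℚ : List ℚ → ℚ
sumℚ = foldr _+_ 0ℚ

w : (H : ℕ) → .{{_ : NonZero H}} → ℤ → ℚ
w H h = (1ℚ - (+ ℤ.∣ h ∣ / H) * ½) ⊔ 0ℚ

-- the positive integers m with M < m^k ≤ M'.
-- Any such m satisfies m ≤ m^k ≤ M', hence m ≤ ⌊M'⌋, so searching 1..⌊M'⌋ is exhaustive.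
range : (k : ℕ) (M M' : ℚ) → List ℕ
range k M M' =
  filterᵇ (λ m → not (ι (m ℕ.^ k) ≤ᵇ M) ∧ (ι (m ℕ.^ k) ≤ᵇ M'))
          (map suc (upTo ℤ.∣ floor M' ∣))

Φ0 : (k H : ℕ) → .{{_ : NonZero H}} → (M M' : ℚ) → ℚ
Φ0 k H M M' =
  sumℚ (map (λ m₁ → sumℚ (map (λ m₂ → w H (+ (m₁ ℕ.^ k) ℤ.- + (m₂ ℕ.^ k))) (range k M M')))
            (range k M M'))

module Submission where

-- Let a be the least element of the window {m : M < m^k ≤ M'}. Every m of the window
-- satisfies a ≤ m < 2a, because m^k ≤ M' ≤ 2M < 2a^k ≤ (2a)^k. For a ≤ m₁, m₂ we have
-- |m₁^k - m₂^k| ≥ |m₁ - m₂| a^(k-1), so w(m₁^k - m₂^k) ≠ 0 forces |m₁ - m₂| ≤ r := ⌊2H / a^(k-1)⌋.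
-- Since 0 ≤ w ≤ 1, every row of Φ(0) is at most 2r + 1, and there are at most a rows. From
-- a^k ≤ 2M and M^(k-1) ≤ H^k we get (a^(k-1))^k ≤ (2H)^k, i.e. a^(k-1) ≤ 2H, hence
-- Φ(0) a^(k-2) ≤ (2r + 1) a^(k-1) ≤ 6H. Raising this to the k-th power and using M < a^k gives
-- Φ(0)^k M^(k-2) ≤ (6H)^k.

open import Defs
open import Algebra.Bundles using (CommutativeRing)
open import Algebra.Properties.CommutativeSemigroup using (interchange)
open import Data.Bool using (Bool; T; not; _∧_)
open import Data.Bool.Properties using (T?; T-∧; T-not-≡)
open import Data.Empty using (⊥-elim)
open import Data.Integer as ℤ using (ℤ; +_)
import Data.Integer.Properties as ℤP
open import Data.List using (List; []; _∷_; map; length; filter; upTo)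
open import Data.List.Relation.Unary.All as All using (All; []; _∷_)
open import Data.List.Relation.Unary.All.Properties using (all-filter; filter⁺)
open import Data.List.Relation.Unary.AllPairs as AllPairs using (AllPairs; []; _∷_)
import Data.List.Relation.Unary.AllPairs.Properties as AllPairsP
open import Data.Nat as ℕ using (ℕ; zero; suc; NonZero; _∸_; _^_; ∣_-_∣; z≤n; s≤s)
open import Data.Nat.DivMod using (_/_; m/n*n≤m; m*n/n≡m; /-monoˡ-≤)
import Data.Nat.Properties as ℕP
open import Data.Product using (Σ; _×_; _,_; proj₁)
open import Data.Rational as ℚ
  using (ℚ; _≤_; _<_; _+_; _*_; _-_; 0ℚ; 1ℚ; ½; _≤ᵇ_; floor; toℚᵘ; nonNegative)
import Data.Rational.Properties as ℚP
open import Data.Rational.Unnormalised as ℚᵘ using (ℚᵘ; mkℚᵘ; *≡*; *≤*) renaming (_≃_ to _≃ᵘ_)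
import Data.Rational.Unnormalised.Properties as ℚᵘP
open import Data.Sum using (inj₁; inj₂)
open import Function using (_∘_; id; Equivalence)
open import Relation.Binary.PropositionalEquality
open import Relation.Nullary using (¬_; yes; no)
open import Relation.Unary using (Pred; Decidable)

ιᵘ : ℕ → ℚᵘ
ιᵘ n = mkℚᵘ (+ n) 0

toℚᵘ-ι : ∀ n → toℚᵘ (ι n) ≃ᵘ ιᵘ n
toℚᵘ-ι n = ℚP.toℚᵘ-fromℚᵘ (ιᵘ n)

ιᵘ-homo-+ : ∀ m n → ιᵘ (m ℕ.+ n) ≃ᵘ ιᵘ m ℚᵘ.+ ιᵘ n
ιᵘ-homo-+ m n = *≡* (cong (ℤ._* + 1)
  (trans (ℤP.pos-+ m n) (sym (cong₂ ℤ._+_ (ℤP.*-identityʳ (+ m)) (ℤP.*-identityʳ (+ n))))))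

ιᵘ-homo-* : ∀ m n → ιᵘ (m ℕ.* n) ≃ᵘ ιᵘ m ℚᵘ.* ιᵘ n
ιᵘ-homo-* m n = *≡* (cong (ℤ._* + 1) (ℤP.pos-* m n))

ι-homo-+ : ∀ m n → ι (m ℕ.+ n) ≡ ι m + ι n
ι-homo-+ m n = ℚP.toℚᵘ-injective (begin-equality
  toℚᵘ (ι (m ℕ.+ n))         ≃⟨ toℚᵘ-ι (m ℕ.+ n) ⟩
  ιᵘ (m ℕ.+ n)               ≃⟨ ιᵘ-homo-+ m n ⟩
  ιᵘ m ℚᵘ.+ ιᵘ n             ≃⟨ ℚᵘP.+-cong (toℚᵘ-ι m) (toℚᵘ-ι n) ⟨
  toℚᵘ (ι m) ℚᵘ.+ toℚᵘ (ι n) ≃⟨ ℚP.toℚᵘ-homo-+ (ι m) (ι n) ⟨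
  toℚᵘ (ι m + ι n)           ∎)
  where open ℚᵘP.≤-Reasoning

ι-homo-* : ∀ m n → ι (m ℕ.* n) ≡ ι m * ι n
ι-homo-* m n = ℚP.toℚᵘ-injective (begin-equality
  toℚᵘ (ι (m ℕ.* n))         ≃⟨ toℚᵘ-ι (m ℕ.* n) ⟩
  ιᵘ (m ℕ.* n)               ≃⟨ ιᵘ-homo-* m n ⟩
  ιᵘ m ℚᵘ.* ιᵘ n             ≃⟨ ℚᵘP.*-cong (toℚᵘ-ι m) (toℚᵘ-ι n) ⟨
  toℚᵘ (ι m) ℚᵘ.* toℚᵘ (ι n) ≃⟨ ℚP.toℚᵘ-homo-* (ι m) (ι n) ⟨
  toℚᵘ (ι m * ι n)           ∎)
  where open ℚᵘP.≤-Reasoning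

ι-homo-^ : ∀ n k → ι (n ^ k) ≡ powℚ (ι n) k
ι-homo-^ n zero    = refl
ι-homo-^ n (suc k) = trans (ι-homo-* n (n ^ k)) (cong (ι n *_) (ι-homo-^ n k))

ι-mono-≤ : ∀ {m n} → m ℕ.≤ n → ι m ≤ ι n
ι-mono-≤ {m} {n} m≤n = ℚP.toℚᵘ-cancel-≤ (begin
  toℚᵘ (ι m) ≃⟨ toℚᵘ-ι m ⟩
  ιᵘ m       ≤⟨ *≤* (ℤP.*-monoʳ-≤-nonNeg (+ 1) (ℤ.+≤+ m≤n)) ⟩
  ιᵘ n       ≃⟨ toℚᵘ-ι n ⟨
  toℚᵘ (ι n) ∎)
  where open ℚᵘP.≤-Reasoning

ι-cancel-≤ : ∀ {m n} → ι m ≤ ι n → m ℕ.≤ n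
ι-cancel-≤ {m} {n} ιm≤ιn = ℤP.drop‿+≤+ (ℤP.*-cancelʳ-≤-pos _ _ (+ 1) (ℚᵘP.drop-*≤* (begin
  ιᵘ m       ≃⟨ toℚᵘ-ι m ⟨
  toℚᵘ (ι m) ≤⟨ ℚP.toℚᵘ-mono-≤ ιm≤ιn ⟩
  toℚᵘ (ι n) ≃⟨ toℚᵘ-ι n ⟩
  ιᵘ n       ∎)))
  where open ℚᵘP.≤-Reasoning

ι-cancel-< : ∀ {m n} → ι m < ι n → m ℕ.< n
ι-cancel-< ιm<ιn = ℕP.≰⇒> (ℚP.<-irrefl refl ∘ ℚP.<-≤-trans ιm<ιn ∘ ι-mono-≤)

ι-nonNeg : ∀ n → 0ℚ ≤ ι n
ι-nonNeg n = ι-mono-≤ {0} {n} z≤n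

*-mono-≤-nonNeg : ∀ {p q r s} → 0ℚ ≤ p → p ≤ q → 0ℚ ≤ r → r ≤ s → p * r ≤ q * s
*-mono-≤-nonNeg {p} {q} {r} {s} 0≤p p≤q 0≤r r≤s = ℚP.≤-trans
  (ℚP.*-monoʳ-≤-nonNeg r {{nonNegative 0≤r}} p≤q)
  (ℚP.*-monoˡ-≤-nonNeg q {{nonNegative (ℚP.≤-trans 0≤p p≤q)}} r≤s)

*-nonNeg : ∀ {p q} → 0ℚ ≤ p → 0ℚ ≤ q → 0ℚ ≤ p * q
*-nonNeg 0≤p 0≤q = *-mono-≤-nonNeg ℚP.≤-refl 0≤p ℚP.≤-refl 0≤q

powℚ-nonNeg : ∀ {p} k → 0ℚ ≤ p → 0ℚ ≤ powℚ p k
powℚ-nonNeg zero    0≤p = ι-nonNeg 1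
powℚ-nonNeg (suc k) 0≤p = *-nonNeg 0≤p (powℚ-nonNeg k 0≤p)

powℚ-mono-≤ : ∀ {p q} k → 0ℚ ≤ p → p ≤ q → powℚ p k ≤ powℚ q k
powℚ-mono-≤ zero    0≤p p≤q = ℚP.≤-refl
powℚ-mono-≤ (suc k) 0≤p p≤q =
  *-mono-≤-nonNeg 0≤p p≤q (powℚ-nonNeg k 0≤p) (powℚ-mono-≤ k 0≤p p≤q)

powℚ-distrib-* : ∀ p q k → powℚ (p * q) k ≡ powℚ p k * powℚ q k
powℚ-distrib-* p q zero    = refl
powℚ-distrib-* p q (suc k) = trans (cong (p * q *_) (powℚ-distrib-* p q k))
  (interchange (CommutativeRing.*-commutativeSemigroup ℚP.+-*-commutativeRing)
    p q (powℚ p k) (powℚ q k))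

module _ {A : Set} where

  sumℚ-nonNeg : ∀ {f : A → ℚ} → (∀ x → 0ℚ ≤ f x) → ∀ xs → 0ℚ ≤ sumℚ (map f xs)
  sumℚ-nonNeg 0≤f []       = ℚP.≤-refl
  sumℚ-nonNeg 0≤f (x ∷ xs) = ℚP.+-mono-≤ (0≤f x) (sumℚ-nonNeg 0≤f xs)

  sumℚ-≤-length* : ∀ {f : A → ℚ} {c xs} → All (λ x → f x ≤ ι c) xs →
    sumℚ (map f xs) ≤ ι (length xs ℕ.* c)
  sumℚ-≤-length*                  []             = ι-nonNeg 0
  sumℚ-≤-length* {f} {c} {x ∷ xs} (fx≤c ∷ fxs≤c) = begin
    f x + sumℚ (map f xs)     ≤⟨ ℚP.+-mono-≤ fx≤c (sumℚ-≤-length* fxs≤c) ⟩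
    ι c + ι (length xs ℕ.* c) ≡⟨ ι-homo-+ c (length xs ℕ.* c) ⟨
    ι (c ℕ.+ length xs ℕ.* c) ∎
    where open ℚP.≤-Reasoning

  sumℚ-≤-length-filter : ∀ {ℓ} {P : Pred A ℓ} (P? : Decidable P) {f : A → ℚ} →
    (∀ x → f x ≤ 1ℚ) → (∀ x → ¬ P x → f x ≤ 0ℚ) →
    ∀ xs → sumℚ (map f xs) ≤ ι (length (filter P? xs))
  sumℚ-≤-length-filter P? f≤1 f≤0 [] = ℚP.≤-refl
  sumℚ-≤-length-filter P? {f} f≤1 f≤0 (x ∷ xs) with P? x
  ... | yes _ = begin
    f x + sumℚ (map f xs) ≤⟨ ℚP.+-mono-≤ (f≤1 x) (sumℚ-≤-length-filter P? f≤1 f≤0 xs) ⟩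
    1ℚ + ι n              ≡⟨ ι-homo-+ 1 n ⟨
    ι (suc n)             ∎
    where open ℚP.≤-Reasoning; n = length (filter P? xs)
  ... | no ¬Px = begin
    f x + sumℚ (map f xs) ≤⟨ ℚP.+-mono-≤ (f≤0 x ¬Px) (sumℚ-≤-length-filter P? f≤1 f≤0 xs) ⟩
    0ℚ + ι n              ≡⟨ ℚP.+-identityˡ (ι n) ⟩
    ι n                   ∎
    where open ℚP.≤-Reasoning; n = length (filter P? xs)

length≤hi∸lo : ∀ {lo hi xs} → AllPairs ℕ._<_ xs → All (λ x → lo ℕ.≤ x × x ℕ.< hi) xs →
  length xs ℕ.≤ hi ∸ lo
length≤hi∸lo [] [] = z≤n
length≤hi∸lo {lo} {hi} {x ∷ xs} (x<xs ∷ sorted) ((lo≤x , x<hi) ∷ bounds) = begin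
  suc (length xs)  ≤⟨ s≤s (length≤hi∸lo sorted (All.zipWith inTail (x<xs , bounds))) ⟩
  suc (hi ∸ suc x) ≡⟨ ℕP.+-∸-assoc 1 x<hi ⟨
  hi ∸ x           ≤⟨ ℕP.∸-monoʳ-≤ hi lo≤x ⟩
  hi ∸ lo          ∎
  where
  open ℕP.≤-Reasoning
  inTail : ∀ {y} → x ℕ.< y × lo ℕ.≤ y × y ℕ.< hi → suc x ℕ.≤ y × y ℕ.< hi
  inTail (x<y , _ , y<hi) = x<y , y<hi

length≤1+2r : ∀ {c r xs} → AllPairs ℕ._<_ xs → All (λ x → ∣ c - x ∣ ℕ.≤ r) xs →
  length xs ℕ.≤ suc (r ℕ.+ r)
length≤1+2r {c} {r} sorted near = ℕP.≤-trans (length≤hi∸lo sorted (All.map ball⊆interval near))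
  (ℕP.m≤n+o⇒m∸n≤o (suc (c ℕ.+ r)) (c ∸ r) (begin
    suc (c ℕ.+ r)             ≤⟨ s≤s (ℕP.+-monoˡ-≤ r (ℕP.m≤n+m∸n c r)) ⟩
    suc (r ℕ.+ (c ∸ r) ℕ.+ r) ≡⟨ cong (λ t → suc (t ℕ.+ r)) (ℕP.+-comm r (c ∸ r)) ⟩
    suc (c ∸ r ℕ.+ r ℕ.+ r)   ≡⟨ cong suc (ℕP.+-assoc (c ∸ r) r r) ⟩
    suc (c ∸ r ℕ.+ (r ℕ.+ r)) ≡⟨ ℕP.+-suc (c ∸ r) (r ℕ.+ r) ⟨
    c ∸ r ℕ.+ suc (r ℕ.+ r)   ∎))
  where
  open ℕP.≤-Reasoning
  ball⊆interval : ∀ {x} → ∣ c - x ∣ ℕ.≤ r → c ∸ r ℕ.≤ x × x ℕ.< suc (c ℕ.+ r)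
  ball⊆interval {x} c≈x =
    ℕP.m≤n+o⇒m∸n≤o c r (ℕP.≤-trans (ℕP.m≤∣m-n∣+n c x) (ℕP.+-monoˡ-≤ x c≈x)) ,
    s≤s (ℕP.≤-trans (ℕP.m≤n+∣n-m∣ x c) (ℕP.+-monoʳ-≤ c c≈x))

[n∸m]*a^i≤n^[1+i]∸m^[1+i] : ∀ i {a m n} → a ℕ.≤ m → m ℕ.≤ n →
  (n ∸ m) ℕ.* a ^ i ℕ.≤ n ^ suc i ∸ m ^ suc i
[n∸m]*a^i≤n^[1+i]∸m^[1+i] i {a} {m} {n} a≤m m≤n = ℕP.m+n≤o⇒m≤o∸n _ (begin
  (n ∸ m) ℕ.* a ^ i ℕ.+ m ℕ.* m ^ i ≤⟨ ℕP.+-monoˡ-≤ _ (ℕP.*-monoʳ-≤ (n ∸ m) (ℕP.^-monoˡ-≤ i a≤m)) ⟩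
  (n ∸ m) ℕ.* m ^ i ℕ.+ m ℕ.* m ^ i ≡⟨ ℕP.*-distribʳ-+ (m ^ i) (n ∸ m) m ⟨
  (n ∸ m ℕ.+ m) ℕ.* m ^ i           ≡⟨ cong (ℕ._* m ^ i) (ℕP.m∸n+n≡m m≤n) ⟩
  n ℕ.* m ^ i                       ≤⟨ ℕP.*-monoʳ-≤ n (ℕP.^-monoˡ-≤ i m≤n) ⟩
  n ℕ.* n ^ i                       ∎)
  where open ℕP.≤-Reasoning

∣m-n∣*a^i≤∣m^[1+i]-n^[1+i]∣ : ∀ i {a m n} → a ℕ.≤ m → a ℕ.≤ n →
  ∣ m - n ∣ ℕ.* a ^ i ℕ.≤ ∣ m ^ suc i - n ^ suc i ∣
∣m-n∣*a^i≤∣m^[1+i]-n^[1+i]∣ i {a} {m} {n} a≤m a≤n with ℕP.≤-total m n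
... | inj₁ m≤n = subst₂ ℕ._≤_
  (cong (ℕ._* a ^ i) (sym (ℕP.m≤n⇒∣m-n∣≡n∸m m≤n)))
  (sym (ℕP.m≤n⇒∣m-n∣≡n∸m (ℕP.^-monoˡ-≤ (suc i) m≤n)))
  ([n∸m]*a^i≤n^[1+i]∸m^[1+i] i a≤m m≤n)
... | inj₂ n≤m = subst₂ ℕ._≤_
  (cong (ℕ._* a ^ i) (sym (ℕP.m≤n⇒∣n-m∣≡n∸m n≤m)))
  (sym (ℕP.m≤n⇒∣n-m∣≡n∸m (ℕP.^-monoˡ-≤ (suc i) n≤m)))
  ([n∸m]*a^i≤n^[1+i]∸m^[1+i] i a≤n n≤m)

m*n≤o⇒m≤o/n : ∀ m n {o} .{{_ : NonZero n}} → m ℕ.* n ℕ.≤ o → m ℕ.≤ o / n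
m*n≤o⇒m≤o/n m n m*n≤o = subst (ℕ._≤ _ / n) (m*n/n≡m m n) (/-monoˡ-≤ n m*n≤o)

[1+2[B/A]]*A≤3*B : ∀ A B .{{_ : NonZero A}} → A ℕ.≤ B → suc (B / A ℕ.+ B / A) ℕ.* A ℕ.≤ 3 ℕ.* B
[1+2[B/A]]*A≤3*B A B A≤B = begin
  suc (r ℕ.+ r) ℕ.* A         ≡⟨ cong (A ℕ.+_) (ℕP.*-distribʳ-+ A r r) ⟩
  A ℕ.+ (r ℕ.* A ℕ.+ r ℕ.* A) ≤⟨ ℕP.+-mono-≤ A≤B (ℕP.+-mono-≤ (m/n*n≤m B A) (m/n*n≤m B A)) ⟩
  B ℕ.+ (B ℕ.+ B)             ≡⟨ cong (λ t → B ℕ.+ (B ℕ.+ t)) (ℕP.+-identityʳ B) ⟨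
  3 ℕ.* B                     ∎
  where open ℕP.≤-Reasoning; r = B / A

^-cancelˡ-< : ∀ k {m n} → m ^ k ℕ.< n ^ k → m ℕ.< n
^-cancelˡ-< k mᵏ<nᵏ = ℕP.≰⇒> (ℕP.<⇒≱ mᵏ<nᵏ ∘ ℕP.^-monoˡ-≤ k)

^-cancelˡ-≤ : ∀ i {m n} → m ^ suc i ℕ.≤ n ^ suc i → m ℕ.≤ n
^-cancelˡ-≤ i mᵏ≤nᵏ = ℕP.≮⇒≥ (λ n<m → ℕP.<⇒≱ (ℕP.^-monoˡ-< (suc i) n<m) mᵏ≤nᵏ)

[m^n]^o≡[m^o]^n : ∀ m n o → (m ^ n) ^ o ≡ (m ^ o) ^ n
[m^n]^o≡[m^o]^n m n o = begin
  (m ^ n) ^ o   ≡⟨ ℕP.^-*-assoc m n o ⟩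
  m ^ (n ℕ.* o) ≡⟨ cong (m ^_) (ℕP.*-comm n o) ⟩
  m ^ (o ℕ.* n) ≡⟨ ℕP.^-*-assoc m o n ⟨
  (m ^ o) ^ n   ∎
  where open ≡-Reasoning

2*a^[1+i]≤[2*a]^[1+i] : ∀ i a → 2 ℕ.* a ^ suc i ℕ.≤ (2 ℕ.* a) ^ suc i
2*a^[1+i]≤[2*a]^[1+i] i a = begin
  2 ℕ.* (a ℕ.* a ^ i)       ≡⟨ ℕP.*-assoc 2 a (a ^ i) ⟨
  2 ℕ.* a ℕ.* a ^ i         ≤⟨ ℕP.*-monoʳ-≤ (2 ℕ.* a) (ℕP.^-monoˡ-≤ i (ℕP.m≤m+n a (a ℕ.+ 0))) ⟩
  2 ℕ.* a ℕ.* (2 ℕ.* a) ^ i ∎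
  where open ℕP.≤-Reasoning

∣+m-+n∣≡∣m-n∣ : ∀ m n → ℤ.∣ + m ℤ.- + n ∣ ≡ ∣ m - n ∣
∣+m-+n∣≡∣m-n∣ m n with ℕP.≤-total m n
... | inj₁ m≤n = trans (cong ℤ.∣_∣ (ℤP.m-n≡m⊖n m n))
  (trans (ℤP.∣⊖∣-≤ m≤n) (sym (ℕP.m≤n⇒∣m-n∣≡n∸m m≤n)))
... | inj₂ n≤m = trans (cong ℤ.∣_∣ (ℤP.m-n≡m⊖n m n))
  (trans (ℤP.∣m⊖n∣≡∣n⊖m∣ m n) (trans (ℤP.∣⊖∣-≤ n≤m) (sym (ℕP.m≤n⇒∣n-m∣≡n∸m n≤m))))

1≤[n/H]*½ : ∀ n H .{{_ : NonZero H}} → 2 ℕ.* H ℕ.≤ n → 1ℚ ≤ (+ n ℚ./ H) * ½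
1≤[n/H]*½ n H@(suc h) 2H≤n = ℚP.toℚᵘ-cancel-≤ (begin
  toℚᵘ 1ℚ                      ≤⟨ *≤* (subst₂ ℤ._≤_ (sym (ℤP.*-identityˡ _)) (sym n*1*1≡n) 2H≤n′) ⟩
  mkℚᵘ (+ n) h ℚᵘ.* toℚᵘ ½     ≃⟨ ℚᵘP.*-cong (ℚP.toℚᵘ-fromℚᵘ (mkℚᵘ (+ n) h)) ℚᵘP.≃-refl ⟨
  toℚᵘ (+ n ℚ./ H) ℚᵘ.* toℚᵘ ½ ≃⟨ ℚP.toℚᵘ-homo-* (+ n ℚ./ H) ½ ⟨
  toℚᵘ ((+ n ℚ./ H) * ½)       ∎)
  where
  open ℚᵘP.≤-Reasoning
  n*1*1≡n = trans (ℤP.*-identityʳ _) (ℤP.*-identityʳ (+ n))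
  2H≤n′ = ℤ.+≤+ (subst (ℕ._≤ n) (ℕP.*-comm 2 H) 2H≤n)

module _ (H : ℕ) .{{_ : NonZero H}} where

  private
    slope : ℤ → ℚ
    slope h = (+ ℤ.∣ h ∣ ℚ./ H) * ½

  w-nonNeg : ∀ h → 0ℚ ≤ w H h
  w-nonNeg h = ℚP.p≤q⊔p (1ℚ - slope h) 0ℚ

  w≤1 : ∀ h → w H h ≤ 1ℚ
  w≤1 h = ℚP.⊔-lub (ℚP.+-monoʳ-≤ 1ℚ (ℚP.neg-antimono-≤ 0≤slope)) (ι-nonNeg 1)
    where
    0≤slope : 0ℚ ≤ slope h
    0≤slope = *-nonNeg
      (ℚP.nonNegative⁻¹ (+ ℤ.∣ h ∣ ℚ./ H) {{ℚP.normalize-nonNeg ℤ.∣ h ∣ H}})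
      (ℚP.nonNegative⁻¹ ½)

  w-vanishes : ∀ h → 2 ℕ.* H ℕ.≤ ℤ.∣ h ∣ → w H h ≡ 0ℚ
  w-vanishes h 2H≤∣h∣ =
    ℚP.p≤q⇒p⊔q≡q (ℚP.+-monoʳ-≤ 1ℚ (ℚP.neg-antimono-≤ (1≤[n/H]*½ ℤ.∣ h ∣ H 2H≤∣h∣)))

Φ0-on : (k H : ℕ) → .{{_ : NonZero H}} → List ℕ → ℚ
Φ0-on k H xs = sumℚ (map (λ m₁ → sumℚ (map (λ m₂ → w H (+ (m₁ ^ k) ℤ.- + (m₂ ^ k))) xs)) xs)

Φ0-on-nonNeg : ∀ k H .{{_ : NonZero H}} xs → 0ℚ ≤ Φ0-on k H xs
Φ0-on-nonNeg k H xs =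
  sumℚ-nonNeg (λ m₁ → sumℚ-nonNeg (λ m₂ → w-nonNeg H (+ (m₁ ^ k) ℤ.- + (m₂ ^ k))) xs) xs

Φ0-on-≤ : ∀ i H a .{{_ : NonZero H}} .{{_ : NonZero (a ^ i)}} xs →
  AllPairs ℕ._<_ xs → All (λ m → a ℕ.≤ m × m ℕ.< 2 ℕ.* a) xs →
  let r = 2 ℕ.* H / a ^ i in Φ0-on (suc i) H xs ≤ ι (a ℕ.* suc (r ℕ.+ r))
Φ0-on-≤ i H a xs sorted bounds = begin
  Φ0-on (suc i) H xs              ≤⟨ sumℚ-≤-length* (All.map (row≤ ∘ proj₁) bounds) ⟩
  ι (length xs ℕ.* suc (r ℕ.+ r)) ≤⟨ ι-mono-≤ (ℕP.*-monoˡ-≤ (suc (r ℕ.+ r)) length≤a) ⟩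
  ι (a ℕ.* suc (r ℕ.+ r))         ∎
  where
  open ℚP.≤-Reasoning
  k = suc i
  r = 2 ℕ.* H / a ^ i

  length≤a : length xs ℕ.≤ a
  length≤a = ℕP.≤-trans (length≤hi∸lo sorted bounds)
    (ℕP.≤-reflexive (trans (ℕP.m+n∸m≡n a (a ℕ.+ 0)) (ℕP.+-identityʳ a)))

  Near : ℕ → ℕ → Set
  Near m₁ m₂ = ∣ m₁ ^ k - m₂ ^ k ∣ ℕ.< 2 ℕ.* H

  near? : ∀ m₁ → Decidable (Near m₁)
  near? m₁ m₂ = ∣ m₁ ^ k - m₂ ^ k ∣ ℕP.<? 2 ℕ.* H

  near⇒close : ∀ {m₁ m₂} → a ℕ.≤ m₁ → a ℕ.≤ m₂ → Near m₁ m₂ → ∣ m₁ - m₂ ∣ ℕ.≤ r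
  near⇒close a≤m₁ a≤m₂ near = m*n≤o⇒m≤o/n _ (a ^ i)
    (ℕP.≤-trans (∣m-n∣*a^i≤∣m^[1+i]-n^[1+i]∣ i a≤m₁ a≤m₂) (ℕP.<⇒≤ near))

  row≤ : ∀ {m₁} → a ℕ.≤ m₁ →
    sumℚ (map (λ m₂ → w H (+ (m₁ ^ k) ℤ.- + (m₂ ^ k))) xs) ≤ ι (suc (r ℕ.+ r))
  row≤ {m₁} a≤m₁ = begin
    sumℚ (map (λ m₂ → w H (+ (m₁ ^ k) ℤ.- + (m₂ ^ k))) xs)
      ≤⟨ sumℚ-≤-length-filter (near? m₁) (λ m₂ → w≤1 H (+ (m₁ ^ k) ℤ.- + (m₂ ^ k))) far⇒w≤0 xs ⟩
    ι (length (filter (near? m₁) xs))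
      ≤⟨ ι-mono-≤ (length≤1+2r {m₁} (AllPairsP.filter⁺ (near? m₁) sorted)
           (All.zipWith (λ (near , a≤m₂ , _) → near⇒close a≤m₁ a≤m₂ near)
             (all-filter (near? m₁) xs , filter⁺ (near? m₁) bounds))) ⟩
    ι (suc (r ℕ.+ r))
      ∎
    where
    far⇒w≤0 : ∀ m₂ → ¬ Near m₁ m₂ → w H (+ (m₁ ^ k) ℤ.- + (m₂ ^ k)) ≤ 0ℚ
    far⇒w≤0 m₂ far = ℚP.≤-reflexive (w-vanishes H (+ (m₁ ^ k) ℤ.- + (m₂ ^ k))
      (subst (2 ℕ.* H ℕ.≤_) (sym (∣+m-+n∣≡∣m-n∣ (m₁ ^ k) (m₂ ^ k))) (ℕP.≮⇒≥ far)))

Φ0-on*a^j≤6H : ∀ j H a .{{_ : NonZero H}} .{{_ : NonZero a}} xs →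
  AllPairs ℕ._<_ xs → All (λ m → a ℕ.≤ m × m ℕ.< 2 ℕ.* a) xs → a ^ suc j ℕ.≤ 2 ℕ.* H →
  Φ0-on (suc (suc j)) H xs * ι (a ^ j) ≤ ι 6 * ι H
Φ0-on*a^j≤6H j H a xs sorted bounds aᵏ⁻¹≤2H = begin
  Φ0-on (suc (suc j)) H xs * ι (a ^ j)
    ≤⟨ *-mono-≤-nonNeg (Φ0-on-nonNeg (suc (suc j)) H xs) (Φ0-on-≤ (suc j) H a xs sorted bounds)
                       (ι-nonNeg (a ^ j)) ℚP.≤-refl ⟩
  ι (a ℕ.* N) * ι (a ^ j) ≡⟨ ι-homo-* (a ℕ.* N) (a ^ j) ⟨
  ι (a ℕ.* N ℕ.* a ^ j)   ≡⟨ cong ι a*N*aʲ≡N*aʲ⁺¹ ⟩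
  ι (N ℕ.* a ^ suc j)     ≤⟨ ι-mono-≤ ([1+2[B/A]]*A≤3*B (a ^ suc j) (2 ℕ.* H) aᵏ⁻¹≤2H) ⟩
  ι (3 ℕ.* (2 ℕ.* H))     ≡⟨ cong ι (ℕP.*-assoc 3 2 H) ⟨
  ι (6 ℕ.* H)             ≡⟨ ι-homo-* 6 H ⟩
  ι 6 * ι H               ∎
  where
  open ℚP.≤-Reasoning
  instance
    aᵏ⁻¹≢0 : NonZero (a ^ suc j)
    aᵏ⁻¹≢0 = ℕP.m^n≢0 a (suc j)
  r = 2 ℕ.* H / a ^ suc j
  N = suc (r ℕ.+ r)
  a*N*aʲ≡N*aʲ⁺¹ : a ℕ.* N ℕ.* a ^ j ≡ N ℕ.* a ^ suc j
  a*N*aʲ≡N*aʲ⁺¹ = trans (cong (ℕ._* a ^ j) (ℕP.*-comm a N)) (ℕP.*-assoc N a (a ^ j))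

Window : ℕ → ℚ → ℚ → ℕ → Set
Window k M M' m = M < ι (m ^ k) × ι (m ^ k) ≤ M'

module _ (k : ℕ) (M M' : ℚ) where

  private
    inWindow : ℕ → Bool
    inWindow m = not (ι (m ^ k) ≤ᵇ M) ∧ (ι (m ^ k) ≤ᵇ M')

  range-window : All (Window k M M') (range k M M')
  range-window = All.map inWindow⇒Window (all-filter (T? ∘ inWindow) (map suc (upTo ℤ.∣ floor M' ∣)))
    where
    inWindow⇒Window : ∀ {m} → T (inWindow m) → Window k M M' m
    inWindow⇒Window t with Equivalence.to T-∧ t
    ... | M<mᵏ , mᵏ≤M' =
      ℚP.≰⇒> (subst T (Equivalence.to T-not-≡ M<mᵏ) ∘ ℚP.≤⇒≤ᵇ) , ℚP.≤ᵇ⇒≤ mᵏ≤M'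

  range-sorted : AllPairs ℕ._<_ (range k M M')
  range-sorted = AllPairsP.filter⁺ (T? ∘ inWindow)
    (AllPairsP.map⁺ (AllPairsP.applyUpTo⁺₁ id ℤ.∣ floor M' ∣ (λ i<j _ → s≤s i<j)))

window⇒<2* : ∀ i {M M' a m} → M' ≤ ι 2 * M → M < ι (a ^ suc i) → ι (m ^ suc i) ≤ M' →
  m ℕ.< 2 ℕ.* a
window⇒<2* i {M} {M'} {a} {m} M'≤2M M<aᵏ mᵏ≤M' = ^-cancelˡ-< (suc i) (ι-cancel-< (begin-strict
  ι (m ^ suc i)         ≤⟨ ℚP.≤-trans mᵏ≤M' M'≤2M ⟩
  ι 2 * M               <⟨ ℚP.*-monoʳ-<-pos (ι 2) M<aᵏ ⟩
  ι 2 * ι (a ^ suc i)   ≡⟨ ι-homo-* 2 (a ^ suc i) ⟨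
  ι (2 ℕ.* a ^ suc i)   ≤⟨ ι-mono-≤ (2*a^[1+i]≤[2*a]^[1+i] i a) ⟩
  ι ((2 ℕ.* a) ^ suc i) ∎))
  where open ℚP.≤-Reasoning

a^i≤2H : ∀ i H {M a} → 0ℚ ≤ M → ι (a ^ suc i) ≤ ι 2 * M → powℚ M i ≤ powℚ (ι H) (suc i) →
  a ^ i ℕ.≤ 2 ℕ.* H
a^i≤2H i H {M} {a} 0≤M aᵏ≤2M Mⁱ≤Hᵏ = ^-cancelˡ-≤ i (ι-cancel-≤ (begin
  ι ((a ^ i) ^ k)             ≡⟨ cong ι ([m^n]^o≡[m^o]^n a i k) ⟩
  ι ((a ^ k) ^ i)             ≡⟨ ι-homo-^ (a ^ k) i ⟩
  powℚ (ι (a ^ k)) i          ≤⟨ powℚ-mono-≤ i (ι-nonNeg (a ^ k)) aᵏ≤2M ⟩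
  powℚ (ι 2 * M) i            ≡⟨ powℚ-distrib-* (ι 2) M i ⟩
  powℚ (ι 2) i * powℚ M i     ≤⟨ *-mono-≤-nonNeg (powℚ-nonNeg i (ι-nonNeg 2)) 2ⁱ≤2ᵏ
                                                 (powℚ-nonNeg i 0≤M) Mⁱ≤Hᵏ ⟩
  powℚ (ι 2) k * powℚ (ι H) k ≡⟨ powℚ-distrib-* (ι 2) (ι H) k ⟨
  powℚ (ι 2 * ι H) k          ≡⟨ cong (λ q → powℚ q k) (ι-homo-* 2 H) ⟨
  powℚ (ι (2 ℕ.* H)) k        ≡⟨ ι-homo-^ (2 ℕ.* H) k ⟨
  ι ((2 ℕ.* H) ^ k)           ∎))
  where
  open ℚP.≤-Reasoning
  k = suc i
  2ⁱ≤2ᵏ : powℚ (ι 2) i ≤ powℚ (ι 2) k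
  2ⁱ≤2ᵏ = subst₂ _≤_ (ι-homo-^ 2 i) (ι-homo-^ 2 k) (ι-mono-≤ (ℕP.^-monoʳ-≤ 2 (ℕP.n≤1+n i)))

powℚ-rescale : ∀ k j a {p q} → 0ℚ ≤ p → 0ℚ ≤ q → q ≤ ι (a ^ k) →
  powℚ p k * powℚ q j ≤ powℚ (p * ι (a ^ j)) k
powℚ-rescale k j a {p} {q} 0≤p 0≤q q≤aᵏ = begin
  powℚ p k * powℚ q j           ≤⟨ *-mono-≤-nonNeg (powℚ-nonNeg k 0≤p) ℚP.≤-refl
                                                   (powℚ-nonNeg j 0≤q) (powℚ-mono-≤ j 0≤q q≤aᵏ) ⟩
  powℚ p k * powℚ (ι (a ^ k)) j ≡⟨ cong (powℚ p k *_) [aᵏ]ʲ≡[aʲ]ᵏ ⟩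
  powℚ p k * powℚ (ι (a ^ j)) k ≡⟨ powℚ-distrib-* p (ι (a ^ j)) k ⟨
  powℚ (p * ι (a ^ j)) k        ∎
  where
  open ℚP.≤-Reasoning
  [aᵏ]ʲ≡[aʲ]ᵏ : powℚ (ι (a ^ k)) j ≡ powℚ (ι (a ^ j)) k
  [aᵏ]ʲ≡[aʲ]ᵏ = trans (sym (ι-homo-^ (a ^ k) j))
    (trans (cong ι ([m^n]^o≡[m^o]^n a k j)) (ι-homo-^ (a ^ j) k))

Φ0-on-window-bound : ∀ j H .{{_ : NonZero H}} {M M'} xs → 1ℚ ≤ M → M' ≤ ι 2 * M →
  powℚ M (suc j) ≤ powℚ (ι H) (suc (suc j)) →
  AllPairs ℕ._<_ xs → All (Window (suc (suc j)) M M') xs →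
  powℚ (Φ0-on (suc (suc j)) H xs) (suc (suc j)) * powℚ M j ≤ powℚ (ι 6 * ι H) (suc (suc j))
Φ0-on-window-bound j H {M} [] _ _ _ _ _ = begin
  (0ℚ * powℚ 0ℚ (suc j)) * powℚ M j ≡⟨ cong (_* powℚ M j) (ℚP.*-zeroˡ (powℚ 0ℚ (suc j))) ⟩
  0ℚ * powℚ M j                     ≡⟨ ℚP.*-zeroˡ (powℚ M j) ⟩
  0ℚ                                ≤⟨ powℚ-nonNeg (suc (suc j)) (*-nonNeg (ι-nonNeg 6) (ι-nonNeg H)) ⟩
  powℚ (ι 6 * ι H) (suc (suc j))    ∎
  where open ℚP.≤-Reasoning
Φ0-on-window-bound j H (zero ∷ _) 1≤M _ _ _ ((M<0 , _) ∷ _) =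
  ⊥-elim (ℚP.<-irrefl refl (ℚP.<-≤-trans M<0 (ℚP.≤-trans (ι-nonNeg 1) 1≤M)))
Φ0-on-window-bound j H xs@(a@(suc _) ∷ _) 1≤M M'≤2M Mᵏ⁻¹≤Hᵏ sorted window@((M<aᵏ , aᵏ≤M') ∷ _) =
  ℚP.≤-trans (powℚ-rescale k j a (Φ0-on-nonNeg k H xs) 0≤M (ℚP.<⇒≤ M<aᵏ))
    (powℚ-mono-≤ k (*-nonNeg (Φ0-on-nonNeg k H xs) (ι-nonNeg (a ^ j)))
      (Φ0-on*a^j≤6H j H a xs sorted bounds aᵏ⁻¹≤2H))
  where
  k = suc (suc j)
  0≤M = ℚP.≤-trans (ι-nonNeg 1) 1≤M

  bounds : All (λ m → a ℕ.≤ m × m ℕ.< 2 ℕ.* a) xs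
  bounds = All.zipWith (λ (a≤m , _ , mᵏ≤M') → a≤m , window⇒<2* (suc j) {a = a} M'≤2M M<aᵏ mᵏ≤M')
    (ℕP.≤-refl ∷ All.map ℕP.<⇒≤ (AllPairs.head sorted) , window)

  aᵏ⁻¹≤2H : a ^ suc j ℕ.≤ 2 ℕ.* H
  aᵏ⁻¹≤2H = a^i≤2H (suc j) H 0≤M (ℚP.≤-trans aᵏ≤M' M'≤2M) Mᵏ⁻¹≤Hᵏ

lemma5 : (k : ℕ) → 2 ℕ.≤ k →
    Σ ℕ (λ C →
      (H : ℕ) → .{{_ : NonZero H}} → (M M' : ℚ) →
      1ℚ ≤ M → M < M' → M' ≤ ι 2 * M →
      powℚ M (k ∸ 1) ≤ powℚ (ι H) k →
      powℚ (Φ0 k H M M') k * powℚ M (k ∸ 2) ≤ powℚ (ι C * ι H) k)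
lemma5 (suc (suc j)) _ = 6 , λ H M M' 1≤M _ M'≤2M Mᵏ⁻¹≤Hᵏ →
  Φ0-on-window-bound j H (range k M M') 1≤M M'≤2M Mᵏ⁻¹≤Hᵏ (range-sorted k M M') (range-window k M M')
  where k = suc (suc j)
lemma5 (suc zero) (s≤s ())
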